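{- Let $I$ be a non-empty set, $(A_i)_{i\in I}$ a family of abelian groups, $X=\bigcup_{i\in I}A_i$ their disjoint union, and let $c_{i,j},d_{i,j}\in A_j$ for $i,j\in I$ be arbitrary constants. Define, for $x\in A_i$ and $y\in A_j$, $\sigma_x(y)=y+c_{i,j}$ and $\tau_y(x)=x+d_{j,i}$. Then $(X,\sigma,\tau)$ is a $2$-reductive solution.
   Context: A solution is a triple $(X,\sigma,\tau)$ with $X$ a non-empty set and bijections $\sigma_x,\tau_y$ of $X$ ($x,y\in X$) such that $r(x,y)=(\sigma_x(y),\tau_y(x))$ is a bijection of $X^2$ satisfying $(\mathrm{id}\times r)(r\times\mathrm{id})(\mathrm{id}\times r)=(r\times\mathrm{id})(\mathrm{id}\times r)(r\times\mathrm{id})$ on $X^3$. It is $2$-reductive if for all $x,y\in X$: $\sigma_{\sigma_x(y)}=\sigma_y$, $\tau_{\tau_x(y)}=\tau_y$, $\sigma_{\tau_x(y)}=\sigma_y$, $\tau_{\sigma_x(y)}=\tau_y$. -}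

module Defs where

open import Level using (Level; _⊔_)
open import Data.Product using (Σ; _×_; _,_; proj₁; proj₂)
open import Function using (Bijective)
open import Relation.Binary.PropositionalEquality using (_≡_)
open import Algebra.Bundles using (AbelianGroup)

r-map : ∀ {a} {X : Set a} → (X → X → X) → (X → X → X) → X × X → X × X
r-map σ τ (x , y) = (σ x y , τ y x)

r×id : ∀ {a} {X : Set a} → (X × X → X × X) → X × (X × X) → X × (X × X)
r×id r (x , y , z) = (proj₁ (r (x , y)) , proj₂ (r (x , y)) , z)

id×r : ∀ {a} {X : Set a} → (X × X → X × X) → X × (X × X) → X × (X × X)
id×r r (x , yz) = (x , r yz)

record IsSolution {a} (X : Set a) (σ τ : X → X → X) : Set a where
  field
    nonEmpty : X
    σ-bij    : ∀ x → Bijective _≡_ _≡_ (σ x)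
    τ-bij    : ∀ y → Bijective _≡_ _≡_ (τ y)
    r-bij    : Bijective _≡_ _≡_ (r-map σ τ)
    braid    : ∀ t → id×r (r-map σ τ) (r×id (r-map σ τ) (id×r (r-map σ τ) t))
                   ≡ r×id (r-map σ τ) (id×r (r-map σ τ) (r×id (r-map σ τ) t))

Is2Reductive : ∀ {a} {X : Set a} → (X → X → X) → (X → X → X) → Set a
Is2Reductive {X = X} σ τ = ∀ (x y : X) →
  (σ (σ x y) ≡ σ y) × (τ (τ x y) ≡ τ y) × (σ (τ x y) ≡ σ y) × (τ (σ x y) ≡ τ y)

record Is2ReductiveSolution {a} (X : Set a) (σ τ : X → X → X) : Set a where
  field
    solution    : IsSolution X σ τ
    twoReductive : Is2Reductive σ τ

module _ {i ℓ} {I : Set i} (A : I → AbelianGroup ℓ ℓ) where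
  open AbelianGroup

  DisjUnion : Set (i ⊔ ℓ)
  DisjUnion = Σ I (λ k → Carrier (A k))

  σ-const : ((k l : I) → Carrier (A l)) → DisjUnion → DisjUnion → DisjUnion
  σ-const c (k , x) (l , y) = (l , _∙_ (A l) y (c k l))

  τ-const : ((k l : I) → Carrier (A l)) → DisjUnion → DisjUnion → DisjUnion
  τ-const d (l , y) (k , x) = (k , _∙_ (A k) x (d l k))

{-# OPTIONS --safe #-}
module Submission where

-- Every σ_x and τ_y is a translation of the component it acts on, by an amount that depends only
-- on the component of x (resp. y), and translations never change components.  Hence σ and τ are
-- invariant under σ and τ (2-reductivity), all translations are invertible, and both sides of the
-- braid relation apply the same two translations to each coordinate, in orders that commute.

open import Defs
open import Level using (_⊔_)
open import Algebra.Bundles using (AbelianGroup)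
import Algebra.Properties.CommutativeSemigroup as CommutativeSemigroupProperties
import Algebra.Properties.Group as GroupProperties
open import Data.Product using (_×_; _,_; proj₁)
open import Function using (Bijective)
open import Function.Bundles using (mk↔ₛ′; Bijection)
open import Function.Definitions using (StrictlyInverseˡ; StrictlyInverseʳ)
open import Function.Properties.Inverse using (↔⇒⤖)
open import Relation.Binary.PropositionalEquality using (_≡_; refl; cong; cong₂)

bijective-from-inverses : ∀ {a} {A : Set a} {f g : A → A} →
  StrictlyInverseˡ _≡_ f g → StrictlyInverseʳ _≡_ f g → Bijective _≡_ _≡_ f
bijective-from-inverses {f = f} {g} f∘g g∘f = Bijection.bijective (↔⇒⤖ (mk↔ₛ′ f g f∘g g∘f))

module TranslationLaws {ℓ} (G : AbelianGroup ℓ ℓ)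
    (≈⇒≡ : ∀ {x y : AbelianGroup.Carrier G} → AbelianGroup._≈_ G x y → x ≡ y) where
  open AbelianGroup G using (_∙_; _⁻¹; group; commutativeSemigroup)

  translate-untranslate : ∀ a y → y ∙ a ⁻¹ ∙ a ≡ y
  translate-untranslate a y = ≈⇒≡ (GroupProperties.//-rightDividesˡ group a y)

  untranslate-translate : ∀ a y → y ∙ a ∙ a ⁻¹ ≡ y
  untranslate-translate a y = ≈⇒≡ (GroupProperties.//-rightDividesʳ group a y)

  translate-comm : ∀ a b y → y ∙ a ∙ b ≡ y ∙ b ∙ a
  translate-comm a b y = ≈⇒≡ (CommutativeSemigroupProperties.xy∙z≈xz∙y commutativeSemigroup y a b)

module _ {i ℓ} {I : Set i} (A : I → AbelianGroup ℓ ℓ)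
    (≈⇒≡ : ∀ k {x y : AbelianGroup.Carrier (A k)} → AbelianGroup._≈_ (A k) x y → x ≡ y) where
  open AbelianGroup using (Carrier; _∙_; _⁻¹)
  module T k = TranslationLaws (A k) (≈⇒≡ k)

  Shift : Set (i ⊔ ℓ)
  Shift = (k : I) → Carrier (A k)

  translate : Shift → DisjUnion A → DisjUnion A
  translate t (k , y) = k , _∙_ (A k) y (t k)

  untranslate : Shift → DisjUnion A → DisjUnion A
  untranslate t (k , y) = k , _∙_ (A k) y (_⁻¹ (A k) (t k))

  translate-untranslate : ∀ t → StrictlyInverseˡ _≡_ (translate t) (untranslate t)
  translate-untranslate t (k , y) = cong (k ,_) (T.translate-untranslate k (t k) y)

  untranslate-translate : ∀ t → StrictlyInverseʳ _≡_ (translate t) (untranslate t)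
  untranslate-translate t (k , y) = cong (k ,_) (T.untranslate-translate k (t k) y)

  translate-bijective : ∀ t → Bijective _≡_ _≡_ (translate t)
  translate-bijective t = bijective-from-inverses (translate-untranslate t) (untranslate-translate t)

  translate-comm : ∀ s t x → translate t (translate s x) ≡ translate s (translate t x)
  translate-comm s t (k , y) = cong (k ,_) (T.translate-comm k (s k) (t k) y)

  module _ (c d : (k l : I) → Carrier (A l)) where
    private
      σ = σ-const A c
      τ = τ-const A d
      r = r-map σ τ

    r-inverse : DisjUnion A × DisjUnion A → DisjUnion A × DisjUnion A
    r-inverse (u , v) = untranslate (d (proj₁ u)) v , untranslate (c (proj₁ v)) u

    r-bijective : Bijective _≡_ _≡_ r
    r-bijective = bijective-from-inverses {g = r-inverse}
      (λ { (u , v) → cong₂ _,_ (translate-untranslate (c (proj₁ v)) u)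
                                (translate-untranslate (d (proj₁ u)) v) })
      (λ { (x , y) → cong₂ _,_ (untranslate-translate (d (proj₁ y)) x)
                                (untranslate-translate (c (proj₁ x)) y) })

    -- Both sides send (x , y , z) to (σ_x σ_y z , σ_x τ_z y , τ_y τ_z x), up to the order of the translations.
    braid : ∀ t → id×r r (r×id r (id×r r t)) ≡ r×id r (id×r r (r×id r t))
    braid ((i , x) , (j , y) , (k , z)) =
      cong₂ _,_ (translate-comm (c j) (c i) (k , z))
        (cong₂ _,_ (translate-comm (d k) (c i) (j , y)) (translate-comm (d k) (d j) (i , x)))

    constant-solution : I → IsSolution (DisjUnion A) σ τ
    constant-solution k = record
      { nonEmpty = k , AbelianGroup.ε (A k)
      ; σ-bij    = λ x → translate-bijective (c (proj₁ x))
      ; τ-bij    = λ y → translate-bijective (d (proj₁ y))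
      ; r-bij    = r-bijective
      ; braid    = braid
      }

    constant-2-reductive : Is2Reductive σ τ
    constant-2-reductive _ _ = refl , refl , refl , refl

theorem3p7 : ∀ {i ℓ} (I : Set i) → I
    → (A : I → AbelianGroup ℓ ℓ)
    → (∀ k {x y : AbelianGroup.Carrier (A k)} → AbelianGroup._≈_ (A k) x y → x ≡ y)
    → (c d : (k l : I) → AbelianGroup.Carrier (A l))
    → Is2ReductiveSolution (DisjUnion A) (σ-const A c) (τ-const A d)
theorem3p7 I k A ≈⇒≡ c d = record
  { solution     = constant-solution A ≈⇒≡ c d k
  ; twoReductive = constant-2-reductive A ≈⇒≡ c d
  }
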